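{- Let $(m,n)\in\mathbb Z^2\setminus\{(0,0)\}$ with $mn\le0$. There is no positive integral $SL_2$-tiling $(u_{i,j})_{i,j\in\mathbb Z}$ with $u_{i+m,j+n}=u_{i,j}$ for all $i,j$.
   Context: An $SL_2$-tiling is a family $(u_{i,j})_{i,j\in\mathbb Z}$ of real numbers such that $u_{i+1,j}u_{i,j+1}-u_{i,j}u_{i+1,j+1}=1$ for all $i,j$. It is positive integral if all $u_{i,j}$ are positive integers. -}

module Defs where

open import Data.Integer using (ℤ; _+_; _-_; _*_; _<_; _≤_; +_; 0ℤ; 1ℤ)
open import Data.Product using (_×_)
open import Relation.Binary.PropositionalEquality using (_≡_)

IsSL2Tiling : (ℤ → ℤ → ℤ) → Set
IsSL2Tiling u = ∀ i j →
  u (i + 1ℤ) j * u i (j + 1ℤ) - u i j * u (i + 1ℤ) (j + 1ℤ) ≡ 1ℤ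

IsPositiveIntegral : (ℤ → ℤ → ℤ) → Set
IsPositiveIntegral u = ∀ i j → 0ℤ < u i j

IsPeriodic : ℤ → ℤ → (ℤ → ℤ → ℤ) → Set
IsPeriodic m n u = ∀ i j → u (i + m) (j + n) ≡ u i j

{-# OPTIONS --safe #-}
-- In a positive SL₂-tiling every 2×2 minor u(i′,j) u(i,j′) − u(i,j) u(i′,j′) with i < i′,
-- j < j′ is positive: the adjacent minors equal 1, and the order x / y < x′ / y′ on pairs
-- with positive denominators is transitive, so it propagates along two adjacent rows and
-- then across rows. A period (m, 0), or (0, n) after transposing, makes such a minor vanish.
-- A period (m, −n) with m, n > 0 turns the minor on rows 0, m and columns j, j + n into
-- r(j) r(j + 2n) < r(j + n)² for the row r = u(0, ·). A strictly log-concave sequence of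
-- positive integers indexed by ℤ cannot exist: once it fails to increase in one direction
-- it strictly decreases forever in that direction.

module Submission where

open import Defs
open import Data.Integer using (ℤ; _*_; _≤_; 0ℤ)
open import Data.Product using (_×_)
open import Relation.Binary.PropositionalEquality using (_≡_)
open import Relation.Nullary using (¬_)

open import Data.Integer using (_+_; _-_; -_; _<_; _≰_; +_; -[1+_]; 1ℤ; ∣_∣; +≤+; +<+)
open import Data.Integer using (positive; nonNegative)
open import Data.Integer.Properties
open import Data.Integer.Tactic.RingSolver using (solve-∀)
open import Data.Nat as ℕ using (zero; suc)
open import Data.Nat.Induction using (<-wellFounded)
open import Data.Product using (_,_)
open import Data.Sum using (inj₁; inj₂)
open import Function using (_∘_; _on_; flip)
open import Induction.InfiniteDescent using (Descent; descent∧wf⇒empty)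
open import Relation.Binary.Construct.On using (wellFounded)
open import Relation.Binary.PropositionalEquality
  using (refl; sym; trans; cong; cong₂; subst; subst₂)

i-j+j≡i : ∀ i j → i - j + j ≡ i
i-j+j≡i = solve-∀

i+j-j≡i : ∀ i j → i + j - j ≡ i
i+j-j≡i = solve-∀

i-j≡1⇒j<i : ∀ {i j} → i - j ≡ 1ℤ → j < i
i-j≡1⇒j<i {i} {j} i-j≡1 =
  suc[i]≤j⇒i<j (≤-reflexive (trans (cong (_+ j) (sym i-j≡1)) (i-j+j≡i i j)))

0≤i<j⇒∣i∣<∣j∣ : ∀ {i j} → 0ℤ ≤ i → i < j → ∣ i ∣ ℕ.< ∣ j ∣
0≤i<j⇒∣i∣<∣j∣ (+≤+ _) (+<+ m<n) = m<n

ratio-<-trans : ∀ {x y x′ y′ x″ y″} → 0ℤ < y → 0ℤ < y′ → 0ℤ < y″ →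
  x * y′ < y * x′ → x′ * y″ < y′ * x″ → x * y″ < y * x″
ratio-<-trans {x} {y} {x′} {y′} {x″} {y″} y>0 y′>0 y″>0 lt₁ lt₂ =
  *-cancelʳ-<-nonNeg y′ {{nonNegative (<⇒≤ y′>0)}} (begin-strict
    x * y″ * y′   ≡⟨ reorder₁ x y″ y′ ⟩
    x * y′ * y″   <⟨ *-monoʳ-<-pos y″ {{positive y″>0}} lt₁ ⟩
    y * x′ * y″   ≡⟨ reorder₂ y x′ y″ ⟩
    y * (x′ * y″) <⟨ *-monoˡ-<-pos y {{positive y>0}} lt₂ ⟩
    y * (y′ * x″) ≡⟨ reorder₃ y y′ x″ ⟩
    y * x″ * y′   ∎)
  where
  open ≤-Reasoning
  reorder₁ : ∀ a b c → a * b * c ≡ a * c * b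
  reorder₁ = solve-∀
  reorder₂ : ∀ a b c → a * b * c ≡ a * (b * c)
  reorder₂ = solve-∀
  reorder₃ : ∀ a b c → a * (b * c) ≡ a * c * b
  reorder₃ = solve-∀

ratio-<-fromSteps : (f g : ℤ → ℤ) → (∀ j → 0ℤ < g j) →
  (∀ j → f j * g (j + 1ℤ) < g j * f (j + 1ℤ)) →
  ∀ j k → f j * g (j + + suc k) < g j * f (j + + suc k)
ratio-<-fromSteps f g g>0 step j zero    = step j
ratio-<-fromSteps f g g>0 step j (suc k) =
  subst (λ j′ → f j * g j′ < g j * f j′) (+-assoc j 1ℤ (+ suc k))
    (ratio-<-trans {x = f j} {x′ = f (j + 1ℤ)} (g>0 _) (g>0 _) (g>0 _)
      (step j) (ratio-<-fromSteps f g g>0 step (j + 1ℤ) k))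

module _ {u : ℤ → ℤ → ℤ} (sl2 : IsSL2Tiling u) (u>0 : IsPositiveIntegral u) where

  adjacentMinor-positive : ∀ i j →
    u i j * u (i + 1ℤ) (j + 1ℤ) < u (i + 1ℤ) j * u i (j + 1ℤ)
  adjacentMinor-positive i j = i-j≡1⇒j<i (sl2 i j)

  minor-positive : ∀ i j a b →
    u i j * u (i + + suc a) (j + + suc b) < u (i + + suc a) j * u i (j + + suc b)
  minor-positive i j a b =
    subst (u i j * u (i + + suc a) j′ <_) (*-comm (u i j′) (u (i + + suc a) j))
      (ratio-<-fromSteps (λ i → u i j) (λ i → u i j′) (λ i → u>0 i j′) adjacentRows i a)
    where
    j′ = j + + suc b
    adjacentRows : ∀ i → u i j * u (i + 1ℤ) j′ < u i j′ * u (i + 1ℤ) j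
    adjacentRows i =
      subst (u i j * u (i + 1ℤ) j′ <_) (*-comm (u (i + 1ℤ) j) (u i j′))
        (ratio-<-fromSteps (u i) (u (i + 1ℤ)) (u>0 (i + 1ℤ)) (adjacentMinor-positive i) j b)

IsStrictlyLogConcave : (ℤ → ℤ) → ℤ → Set
IsStrictlyLogConcave r d = ∀ j → r j * r (j + d + d) < r (j + d) * r (j + d)

isStrictlyLogConcave-reverse : ∀ {r d} →
  IsStrictlyLogConcave r d → IsStrictlyLogConcave r (- d)
isStrictlyLogConcave-reverse {r} {d} lc j = subst₂ _<_
  (trans (*-comm (r k) (r (k + d + d))) (cong (λ i → r i * r k) k+d+d≡j))
  (cong (λ i → r i * r i) (i-j+j≡i (j - d) d))
  (lc k)
  where
  k = j - d - d
  k+d+d≡j : k + d + d ≡ j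
  k+d+d≡j = trans (cong (_+ d) (i-j+j≡i (j - d) d)) (i-j+j≡i j d)

module _ {r : ℤ → ℤ} {d : ℤ} (r>0 : ∀ j → 0ℤ < r j) (lc : IsStrictlyLogConcave r d) where

  isStrictlyLogConcave⇒decreasing : ∀ j → r (j + d) ≤ r j → r (j + d + d) < r (j + d)
  isStrictlyLogConcave⇒decreasing j r[j+d]≤r[j] =
    *-cancelˡ-<-nonNeg (r (j + d)) {{nonNegative (<⇒≤ (r>0 _))}} (begin-strict
      r (j + d) * r (j + d + d) ≤⟨ *-monoʳ-≤-nonNeg (r (j + d + d)) {{r[j+2d]≥0}} r[j+d]≤r[j] ⟩
      r j * r (j + d + d)       <⟨ lc j ⟩
      r (j + d) * r (j + d)     ∎)
    where
    open ≤-Reasoning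
    r[j+2d]≥0 = nonNegative (<⇒≤ (r>0 (j + d + d)))

  isStrictlyLogConcave⇒increasing : ∀ j → r (j + d) ≰ r j
  isStrictlyLogConcave⇒increasing =
    descent∧wf⇒empty descent (wellFounded (λ j → ∣ r (j + d) ∣) <-wellFounded)
    where
    descent : Descent (ℕ._<_ on λ j → ∣ r (j + d) ∣) (λ j → r (j + d) ≤ r j)
    descent {j} r[j+d]≤r[j] =
      j + d , 0≤i<j⇒∣i∣<∣j∣ (<⇒≤ (r>0 _)) r[j+2d]<r[j+d] , <⇒≤ r[j+2d]<r[j+d]
      where r[j+2d]<r[j+d] = isStrictlyLogConcave⇒decreasing j r[j+d]≤r[j]

¬isStrictlyLogConcave : ∀ {r d} → (∀ j → 0ℤ < r j) → ¬ IsStrictlyLogConcave r d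
¬isStrictlyLogConcave {r} {d} r>0 lc with ≤-total (r d) (r 0ℤ)
... | inj₁ r[d]≤r[0] =
  isStrictlyLogConcave⇒increasing r>0 lc 0ℤ
    (subst (λ k → r k ≤ r 0ℤ) (sym (+-identityˡ d)) r[d]≤r[0])
... | inj₂ r[0]≤r[d] =
  isStrictlyLogConcave⇒increasing r>0 (isStrictlyLogConcave-reverse {r} {d} lc) d
    (subst (λ k → r k ≤ r d) (sym (+-inverseʳ d)) r[0]≤r[d])

isSL2Tiling-flip : ∀ {u} → IsSL2Tiling u → IsSL2Tiling (flip u)
isSL2Tiling-flip {u} sl2 i j =
  trans (cong (_- u j i * u (j + 1ℤ) (i + 1ℤ)) (*-comm (u j (i + 1ℤ)) (u (j + 1ℤ) i)))
    (sl2 j i)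

isPositiveIntegral-flip : ∀ {u} → IsPositiveIntegral u → IsPositiveIntegral (flip u)
isPositiveIntegral-flip u>0 i j = u>0 j i

isPeriodic-flip : ∀ {m n u} → IsPeriodic m n u → IsPeriodic n m (flip u)
isPeriodic-flip per i j = per j i

isPeriodic-neg : ∀ {m n u} → IsPeriodic m n u → IsPeriodic (- m) (- n) u
isPeriodic-neg {m} {n} {u} per i j =
  trans (sym (per (i - m) (j - n))) (cong₂ u (i-j+j≡i i m) (i-j+j≡i j n))

¬isPeriodic-pos-nonPos : ∀ {u} → IsSL2Tiling u → IsPositiveIntegral u →
  ∀ a b → ¬ IsPeriodic (+ suc a) (- + b) u
-- Closed indices such as 0ℤ + + suc a and 1ℤ + + 0 compute, so per rewrites the minor as is.
¬isPeriodic-pos-nonPos {u} sl2 u>0 a zero per = <-irrefl refl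
  (subst₂ (λ x y → u 0ℤ 0ℤ * x < y * u 0ℤ 1ℤ) (per 0ℤ 1ℤ) (per 0ℤ 0ℤ)
    (minor-positive sl2 u>0 0ℤ 0ℤ a 0))
¬isPeriodic-pos-nonPos {u} sl2 u>0 a (suc b) per = ¬isStrictlyLogConcave (u>0 0ℤ) lc
  where
  n = + suc b
  shift : ∀ j → u (+ suc a) j ≡ u 0ℤ (j + n)
  shift j = trans (cong (u (+ suc a)) (sym (i+j-j≡i j n))) (per 0ℤ (j + n))
  lc : IsStrictlyLogConcave (u 0ℤ) n
  lc j = subst₂ (λ x y → u 0ℤ j * x < y * u 0ℤ (j + n)) (shift (j + n)) (shift j)
    (minor-positive sl2 u>0 0ℤ j a b)

¬isPeriodic-zero-pos : ∀ {u} → IsSL2Tiling u → IsPositiveIntegral u →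
  ∀ b → ¬ IsPeriodic 0ℤ (+ suc b) u
¬isPeriodic-zero-pos {u} sl2 u>0 b per =
  ¬isPeriodic-pos-nonPos (isSL2Tiling-flip {u} sl2) (isPositiveIntegral-flip u>0) b 0
    (isPeriodic-flip per)

corollary5p5 : (m n : ℤ) → ¬ (m ≡ 0ℤ × n ≡ 0ℤ) → m * n ≤ 0ℤ →
    (u : ℤ → ℤ → ℤ) → IsSL2Tiling u → IsPositiveIntegral u → ¬ IsPeriodic m n u
corollary5p5 (+ zero)  (+ zero)  nonzero _ _ _ _ _ = nonzero (refl , refl)
corollary5p5 (+ suc a) (+ suc b) _ (+≤+ ())
corollary5p5 -[1+ a ]  -[1+ b ]  _ (+≤+ ())
corollary5p5 (+ zero)  (+ suc b) _ _ _ sl2 u>0 = ¬isPeriodic-zero-pos sl2 u>0 b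
corollary5p5 (+ zero)  -[1+ b ]  _ _ _ sl2 u>0 = ¬isPeriodic-zero-pos sl2 u>0 b ∘ isPeriodic-neg
corollary5p5 (+ suc a) (+ zero)  _ _ _ sl2 u>0 = ¬isPeriodic-pos-nonPos sl2 u>0 a 0
corollary5p5 -[1+ a ]  (+ zero)  _ _ _ sl2 u>0 = ¬isPeriodic-pos-nonPos sl2 u>0 a 0 ∘ isPeriodic-neg
corollary5p5 (+ suc a) -[1+ b ]  _ _ _ sl2 u>0 = ¬isPeriodic-pos-nonPos sl2 u>0 a (suc b)
corollary5p5 -[1+ a ]  (+ suc b) _ _ _ sl2 u>0 =
  ¬isPeriodic-pos-nonPos sl2 u>0 a (suc b) ∘ isPeriodic-neg
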